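{- Let $\mathcal{M}_0=(E,r)$ be a matroid with rank function $r$, let $k$ be a positive integer, and let $E_1,E_2\subseteq E$ (not necessarily disjoint) with $E=E_1\cup E_2$. Suppose that $r(E_1),r(E_2)\ge k$ and $r(E_1)+r(E_2)\le r(E)+k-1$. Then $\mathcal{M}_0$ has a vertical $k'$-separation for some $k'\le k$.
   Context: For a matroid $(E,r)$ and a positive integer $k$, a vertical $k$-separation is a bipartition $(E_1,E_2)$ of $E$ (into disjoint sets with union $E$) such that $r(E_1),r(E_2)\ge k$ and $r(E_1)+r(E_2)\le r(E)+k-1$. -}

module Defs where

open import Data.Nat using (ℕ; _+_; _∸_; _≤_; _≥_)
open import Data.Product using (_×_)
open import Data.Fin.Subset using (Subset; _⊆_; _∪_; _∩_; ∣_∣; ⊤; ⊥)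
open import Relation.Binary.PropositionalEquality using (_≡_)

record Matroid (n : ℕ) : Set where
  field
    r          : Subset n → ℕ
    r-bounded  : ∀ X → r X ≤ ∣ X ∣
    r-mono     : ∀ {X Y} → X ⊆ Y → r X ≤ r Y
    r-submod   : ∀ X Y → r (X ∪ Y) + r (X ∩ Y) ≤ r X + r Y

open Matroid public

IsBipartition : ∀ {n} → Subset n → Subset n → Set
IsBipartition E₁ E₂ = (E₁ ∩ E₂ ≡ ⊥) × (E₁ ∪ E₂ ≡ ⊤)

IsVerticalSep : ∀ {n} → Matroid n → ℕ → Subset n → Subset n → Set
IsVerticalSep M k E₁ E₂ =
  IsBipartition E₁ E₂ × r M E₁ ≥ k × r M E₂ ≥ k
    × r M E₁ + r M E₂ ≤ r M ⊤ + k ∸ 1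

{-# OPTIONS --safe #-}
module Submission where

open import Defs
open import Data.Nat using (ℕ; _+_; _∸_; _≤_; _≥_; _<_; suc; s≤s; z≤n)
open import Data.Nat.Properties
open import Data.Product using (_×_; ∃-syntax; _,_)
open import Data.Sum using (inj₁; inj₂)
open import Data.Empty using (⊥-elim)
open import Data.Fin.Subset using (Subset; _∪_; ⊤; ∁; _⊆_; _∈_)
open import Data.Fin.Subset.Properties
  using (∩-inverseʳ; ∪-inverseʳ; x∈∁p⇒x∉p; x∈p∪q⁻; ∈⊤)
open import Relation.Binary.PropositionalEquality
  using (_≡_; sym; subst; cong; module ≡-Reasoning)

-- Replace E₂ by the complement of E₁: this keeps both ranks below r(E)
-- and can only lower r(E₁) + r(E₂). For the bipartition (E₁, E − E₁) the
-- order k' = λ(E₁) + 1, where λ(X) = r(X) + r(E − X) − r(E), makes the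
-- defining inequality of a vertical separation an equality, and the two
-- rank conditions r(E₁), r(E − E₁) ≥ k' are then equivalent to
-- r(E − E₁) < r(E) and r(E₁) < r(E).

m+n≤o+k⇒m<o : ∀ {m n o k} → m + n ≤ o + k → k < n → m < o
m+n≤o+k⇒m<o {m} {n} {o} {k} m+n≤o+k k<n = +-cancelʳ-≤ k (suc m) o (begin
  suc m + k  ≡⟨ sym (+-suc m k) ⟩
  m + suc k  ≤⟨ +-monoʳ-≤ m k<n ⟩
  m + n      ≤⟨ m+n≤o+k ⟩
  o + k      ∎)
  where open ≤-Reasoning

m+n∸o<m : ∀ {m n o} → o ≤ m + n → n < o → m + n ∸ o < m
m+n∸o<m {m} {n} {o} o≤m+n n<o =
  subst (m + n ∸ o <_) (m+n∸n≡m m o) (∸-monoˡ-< (+-monoʳ-< m n<o) o≤m+n)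

m+n∸o<n : ∀ {m n o} → o ≤ m + n → m < o → m + n ∸ o < n
m+n∸o<n {m} {n} {o} o≤m+n m<o =
  subst (_< n) (cong (_∸ o) (+-comm n m))
    (m+n∸o<m (subst (o ≤_) (+-comm m n) o≤m+n) m<o)

∪≡⊤⇒∁⊆ : ∀ {n} {p q : Subset n} → p ∪ q ≡ ⊤ → ∁ p ⊆ q
∪≡⊤⇒∁⊆ {p = p} {q} p∪q≡⊤ {x} x∈∁p with x∈p∪q⁻ p q (subst (x ∈_) (sym p∪q≡⊤) ∈⊤)
... | inj₁ x∈p = ⊥-elim (x∈∁p⇒x∉p x∈∁p x∈p)
... | inj₂ x∈q = x∈q

module _ {n} (M : Matroid n) where

  r-subadditive : ∀ X Y → r M (X ∪ Y) ≤ r M X + r M Y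
  r-subadditive X Y = ≤-trans (m≤m+n _ _) (r-submod M X Y)

  r⊤≤r+r∁ : ∀ X → r M ⊤ ≤ r M X + r M (∁ X)
  r⊤≤r+r∁ X = subst (λ Y → r M Y ≤ r M X + r M (∁ X)) (∪-inverseʳ X) (r-subadditive X (∁ X))

  connectivity : Subset n → ℕ
  connectivity X = r M X + r M (∁ X) ∸ r M ⊤

  connectivity-≤ : ∀ {X Y} → X ∪ Y ≡ ⊤ → connectivity X ≤ r M X + r M Y ∸ r M ⊤
  connectivity-≤ X∪Y≡⊤ =
    ∸-monoˡ-≤ (r M ⊤) (+-monoʳ-≤ (r M _) (r-mono M (∪≡⊤⇒∁⊆ X∪Y≡⊤)))

  complement-isVerticalSep : ∀ X → r M X < r M ⊤ → r M (∁ X) < r M ⊤ →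
    IsVerticalSep M (suc (connectivity X)) X (∁ X)
  complement-isVerticalSep X rX<r⊤ r∁X<r⊤ =
      (∩-inverseʳ X , ∪-inverseʳ X)
    , m+n∸o<m (r⊤≤r+r∁ X) r∁X<r⊤
    , m+n∸o<n (r⊤≤r+r∁ X) rX<r⊤
    , ≤-reflexive sum≡
    where
    open ≡-Reasoning
    sum≡ : r M X + r M (∁ X) ≡ r M ⊤ + suc (connectivity X) ∸ 1
    sum≡ = begin
      r M X + r M (∁ X)              ≡⟨ sym (m+[n∸m]≡n (r⊤≤r+r∁ X)) ⟩
      r M ⊤ + connectivity X         ≡⟨ cong (_∸ 1) (+-suc (r M ⊤) (connectivity X)) ⟨
      r M ⊤ + suc (connectivity X) ∸ 1 ∎

lemma3p3 : ∀ {n} (M : Matroid n) (k : ℕ) → 1 ≤ k →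
    (E₁ E₂ : Subset n) → E₁ ∪ E₂ ≡ ⊤ →
    r M E₁ ≥ k → r M E₂ ≥ k → r M E₁ + r M E₂ ≤ r M ⊤ + k ∸ 1 →
    ∃[ k' ] (1 ≤ k' × k' ≤ k × ∃[ F₁ ] ∃[ F₂ ] IsVerticalSep M k' F₁ F₂)
lemma3p3 M (suc k) _ E₁ E₂ E₁∪E₂≡⊤ k<rE₁ k<rE₂ sum≤ =
    suc (connectivity M E₁) , s≤s z≤n , s≤s connectivity≤k
  , E₁ , ∁ E₁ , complement-isVerticalSep M E₁ rE₁<r⊤ r∁E₁<r⊤
  where
  sum≤′ : r M E₁ + r M E₂ ≤ r M ⊤ + k
  sum≤′ = subst (r M E₁ + r M E₂ ≤_) (cong (_∸ 1) (+-suc (r M ⊤) k)) sum≤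

  rE₁<r⊤ : r M E₁ < r M ⊤
  rE₁<r⊤ = m+n≤o+k⇒m<o sum≤′ k<rE₂

  r∁E₁<r⊤ : r M (∁ E₁) < r M ⊤
  r∁E₁<r⊤ = ≤-<-trans (r-mono M (∪≡⊤⇒∁⊆ E₁∪E₂≡⊤))
              (m+n≤o+k⇒m<o (subst (_≤ r M ⊤ + k) (+-comm (r M E₁) (r M E₂)) sum≤′) k<rE₁)

  connectivity≤k : connectivity M E₁ ≤ k
  connectivity≤k = ≤-trans (connectivity-≤ M E₁∪E₂≡⊤)
    (≤-trans (∸-monoˡ-≤ (r M ⊤) sum≤′) (≤-reflexive (m+n∸m≡n (r M ⊤) k)))
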